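{- Let $M$ be a loopless rank-$4$ hypermodular matroid. Then there is no pair of disjoint flats of $M$ of rank $3$ and $2$ respectively if and only if $M$ is modular.
   Context: A pair of flats $\{A,B\}$ is modular if $r(A\cup B)+r(A\cap B)=r(A)+r(B)$; a matroid is modular if every pair of flats is modular. A rank-$4$ matroid is hypermodular if every pair of two rank-$3$ flats is a modular pair. -}

module Defs where

open import Data.Nat using (ℕ; _≤_; _<_; _+_)
open import Data.Fin using (Fin)
open import Data.Fin.Subset using (Subset; _⊆_; _∪_; _∩_; ∣_∣; ⁅_⁆; _∉_; ⊤; Empty)
open import Data.Product using (Σ; _×_)
open import Relation.Binary.PropositionalEquality using (_≡_)

record Matroid (n : ℕ) : Set where
  field
    r          : Subset n → ℕ
    r-bounded  : ∀ X → r X ≤ ∣ X ∣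
    r-mono     : ∀ {X Y} → X ⊆ Y → r X ≤ r Y
    r-submod   : ∀ X Y → r (X ∪ Y) + r (X ∩ Y) ≤ r X + r Y

module _ {n : ℕ} (M : Matroid n) where
  open Matroid M

  rank : ℕ
  rank = r ⊤

  IsFlat : Subset n → Set
  IsFlat X = ∀ e → e ∉ X → r X < r (X ∪ ⁅ e ⁆)

  Loopless : Set
  Loopless = ∀ e → r ⁅ e ⁆ ≡ 1

  ModularPair : Subset n → Subset n → Set
  ModularPair A B = r (A ∪ B) + r (A ∩ B) ≡ r A + r B

  IsModular : Set
  IsModular = ∀ A B → IsFlat A → IsFlat B → ModularPair A B

  Hypermodular : Set
  Hypermodular = (rank ≡ 4) ×
    (∀ A B → IsFlat A → IsFlat B → r A ≡ 3 → r B ≡ 3 → ModularPair A B)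

  HasDisjoint32 : Set
  HasDisjoint32 = Σ (Subset n) λ A → Σ (Subset n) λ B →
    IsFlat A × IsFlat B × r A ≡ 3 × r B ≡ 2 × Empty (A ∩ B)

{-# OPTIONS --safe #-}
-- Modularity can only fail for incomparable flats A, B, and then r A, r B < r (A ∪ B) ≤ 4.
-- Two planes form a modular pair by hypothesis; if the smaller flat is a point, or a line
-- meeting the other flat, r A + r B ≤ r (A ∪ B) + r (A ∩ B) follows by counting. A line
-- disjoint from a plane is excluded outright, which leaves two disjoint lines spanning only a
-- plane. Adding to one of them a point x outside that plane gives a plane which, by
-- submodularity, still misses the other line: a disjoint pair of flats of ranks 3 and 2.
module Submission where

open import Defs
open import Data.Nat using (ℕ; suc; _+_; _≤_; _<_; z≤n; s≤s; _≤?_; _<?_)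
open import Data.Nat.Properties
  using (≤-refl; ≤-trans; ≤-reflexive; ≤-antisym; ≤-total; ≤-pred; <-≤-trans; <⇒≱; ≮⇒≥; ≰⇒>; n≮n;
         m≤n⇒m<n∨m≡n; n≤0⇒n≡0; m≤m+n; +-comm; +-suc; +-monoˡ-≤; +-monoʳ-≤; +-mono-≤; +-cancelˡ-≤;
         +-cancelʳ-≤; module ≤-Reasoning)
open import Data.Fin.Properties using (any?; _≟_)
open import Data.Fin.Subset
open import Data.Fin.Subset.Properties
  using (_∈?_; _⊆?_; nonempty?; x∈p∪q⁻; x∈p∩q⁺; x∈p∩q⁻; p⊆p∪q; q⊆p∪q; p∩q⊆p;
         x∈⁅x⁆; x∈⁅y⁆⇒x≡y; ∣⁅x⁆∣≡1; ⊆-refl; ⊆⊤; ∪-comm; ∩-comm; p─q⊆p; x∈p∧x≢y⇒x∈p-y;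
         x∈p⇒p-x⊂p; Empty-unique; ∣⊥∣≡0)
open import Data.Fin.Subset.Induction using (⊂-wellFounded)
open import Induction.WellFounded using (Acc; acc)
open import Data.Product using (_×_; _,_; proj₂; ∃)
open import Data.Sum using (inj₁; inj₂; [_,_]′)
open import Data.Empty using (⊥-elim)
open import Data.Bool.Properties using (T-≡)
open import Data.Vec using (tabulate)
open import Data.Vec.Properties using (lookup⇒[]=; []=⇒lookup; lookup∘tabulate)
open import Function.Bundles using (Equivalence)
open import Relation.Nullary using (¬_; Dec; yes; no)
open import Relation.Nullary.Decidable using (⌊_⌋; _×-dec_; ¬?; toWitness; fromWitness; decidable-stable)
open import Relation.Binary.PropositionalEquality

m≤1+o⇒n<p⇒m+n≤p+o : ∀ {m n o p} → m ≤ suc o → n < p → m + n ≤ p + o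
m≤1+o⇒n<p⇒m+n≤p+o {m} {n} {o} {p} m≤1+o n<p = begin
  m + n      ≤⟨ +-monoˡ-≤ n m≤1+o ⟩
  suc o + n  ≡⟨ sym (+-suc o n) ⟩
  o + suc n  ≤⟨ +-monoʳ-≤ o n<p ⟩
  o + p      ≡⟨ +-comm o p ⟩
  p + o      ∎
  where open ≤-Reasoning

module _ {n : ℕ} where

  ∪-least : ∀ {p q s : Subset n} → p ⊆ s → q ⊆ s → p ∪ q ⊆ s
  ∪-least {p} {q} p⊆s q⊆s x∈p∪q = [ p⊆s , q⊆s ]′ (x∈p∪q⁻ p q x∈p∪q)

  ∩-greatest : ∀ {p q s : Subset n} → s ⊆ p → s ⊆ q → s ⊆ p ∩ q
  ∩-greatest s⊆p s⊆q x∈s = x∈p∩q⁺ (s⊆p x∈s , s⊆q x∈s)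

  x∈p⇒⁅x⁆⊆p : ∀ {x} {p : Subset n} → x ∈ p → ⁅ x ⁆ ⊆ p
  x∈p⇒⁅x⁆⊆p {x} {p} x∈p y∈⁅x⁆ = subst (_∈ p) (sym (x∈⁅y⁆⇒x≡y x y∈⁅x⁆)) x∈p

  p⊆p-x∪⁅x⁆ : ∀ (p : Subset n) x → p ⊆ (p - x) ∪ ⁅ x ⁆
  p⊆p-x∪⁅x⁆ p x {y} y∈p with y ≟ x
  ... | yes refl = q⊆p∪q (p - x) ⁅ x ⁆ (x∈⁅x⁆ x)
  ... | no y≢x   = p⊆p∪q ⁅ x ⁆ (x∈p∧x≢y⇒x∈p-y y∈p y≢x)

  ⊈⇒∃∉ : ∀ {p q : Subset n} → p ⊈ q → ∃ λ x → x ∈ p × x ∉ q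
  ⊈⇒∃∉ {p} {q} p⊈q with any? (λ x → x ∈? p ×-dec ¬? (x ∈? q))
  ... | yes witness = witness
  ... | no none     =
    ⊥-elim (p⊈q (λ {x} x∈p → decidable-stable (x ∈? q) (λ x∉q → none (x , x∈p , x∉q))))

module _ {n : ℕ} (M : Matroid n) where
  open Matroid M

  r≤rank : ∀ X → r X ≤ rank M
  r≤rank X = r-mono ⊆⊤

  r-empty : ∀ {X} → Empty X → r X ≡ 0
  r-empty {X} X-empty = n≤0⇒n≡0
    (≤-trans (r-bounded X) (≤-reflexive (trans (cong ∣_∣ (Empty-unique X-empty)) (∣⊥∣≡0 n))))

  r-∪⁅⁆ : ∀ X e → r (X ∪ ⁅ e ⁆) ≤ suc (r X)
  r-∪⁅⁆ X e = begin
    r (X ∪ ⁅ e ⁆)                  ≤⟨ m≤m+n _ _ ⟩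
    r (X ∪ ⁅ e ⁆) + r (X ∩ ⁅ e ⁆)  ≤⟨ r-submod X ⁅ e ⁆ ⟩
    r X + r ⁅ e ⁆                  ≤⟨ +-monoʳ-≤ (r X) (≤-trans (r-bounded ⁅ e ⁆)
                                                              (≤-reflexive (∣⁅x⁆∣≡1 e))) ⟩
    r X + 1                        ≡⟨ +-comm (r X) 1 ⟩
    suc (r X)                      ∎
    where open ≤-Reasoning

  Loopless⇒1≤r : Loopless M → ∀ {x X} → x ∈ X → 1 ≤ r X
  Loopless⇒1≤r loopless {x} {X} x∈X = subst (_≤ r X) (loopless x) (r-mono (x∈p⇒⁅x⁆⊆p x∈X))

  flat⇒r< : ∀ {A X e} → IsFlat M A → A ⊆ X → e ∈ X → e ∉ A → r A < r X
  flat⇒r< fA A⊆X e∈X e∉A = <-≤-trans (fA _ e∉A) (r-mono (∪-least A⊆X (x∈p⇒⁅x⁆⊆p e∈X)))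

  ⊆⇒ModularPair : ∀ {A B} → A ⊆ B → ModularPair M A B
  ⊆⇒ModularPair {A} {B} A⊆B = trans
    (cong₂ _+_ (≤-antisym (r-mono (∪-least A⊆B ⊆-refl)) (r-mono (q⊆p∪q A B)))
               (≤-antisym (r-mono (p∩q⊆p A B)) (r-mono (∩-greatest ⊆-refl A⊆B))))
    (+-comm (r B) (r A))

  ModularPair-sym : ∀ {A B} → ModularPair M A B → ModularPair M B A
  ModularPair-sym {A} {B} AB = begin
    r (B ∪ A) + r (B ∩ A)  ≡⟨ cong₂ _+_ (cong r (∪-comm B A)) (cong r (∩-comm B A)) ⟩
    r (A ∪ B) + r (A ∩ B)  ≡⟨ AB ⟩
    r A + r B              ≡⟨ +-comm (r A) (r B) ⟩
    r B + r A              ∎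
    where open ≡-Reasoning

  Spans : Subset n → Subset n → Set
  Spans S Y = r (S ∪ Y) ≤ r S

  spans? : ∀ S Y → Dec (Spans S Y)
  spans? S Y = r (S ∪ Y) ≤? r S

  Spans-⊆ : ∀ {S Y Z} → Y ⊆ Z → Spans S Z → Spans S Y
  Spans-⊆ {S} {Y} {Z} Y⊆Z = ≤-trans (r-mono (∪-least (p⊆p∪q Z) (λ y∈Y → q⊆p∪q S Z (Y⊆Z y∈Y))))

  Spans-∪ : ∀ {S Y Z} → Spans S Y → Spans S Z → Spans S (Y ∪ Z)
  Spans-∪ {S} {Y} {Z} SY SZ = +-cancelʳ-≤ (r S) _ _ (begin
    r (S ∪ (Y ∪ Z)) + r S                          ≤⟨ +-mono-≤ (r-mono S∪[Y∪Z]⊆) (r-mono S⊆) ⟩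
    r ((S ∪ Y) ∪ (S ∪ Z)) + r ((S ∪ Y) ∩ (S ∪ Z))  ≤⟨ r-submod (S ∪ Y) (S ∪ Z) ⟩
    r (S ∪ Y) + r (S ∪ Z)                          ≤⟨ +-mono-≤ SY SZ ⟩
    r S + r S                                      ∎)
    where
      open ≤-Reasoning
      S∪[Y∪Z]⊆ : S ∪ (Y ∪ Z) ⊆ (S ∪ Y) ∪ (S ∪ Z)
      S∪[Y∪Z]⊆ = ∪-least (λ s → p⊆p∪q (S ∪ Z) (p⊆p∪q Y s))
        (∪-least (λ y → p⊆p∪q (S ∪ Z) (q⊆p∪q S Y y)) (λ z → q⊆p∪q (S ∪ Y) _ (q⊆p∪q S Z z)))
      S⊆ : S ⊆ (S ∪ Y) ∩ (S ∪ Z)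
      S⊆ = ∩-greatest (p⊆p∪q Y) (p⊆p∪q Z)

  Spans-pointwise : ∀ {S} Y → (∀ {e} → e ∈ Y → Spans S ⁅ e ⁆) → Spans S Y
  Spans-pointwise {S} Y = go Y (⊂-wellFounded Y)
    where
      go : ∀ Y → Acc _⊂_ Y → (∀ {e} → e ∈ Y → Spans S ⁅ e ⁆) → Spans S Y
      go Y (acc smaller) spans-points with nonempty? Y
      ... | no Y-empty    = r-mono (∪-least ⊆-refl (λ y∈Y → ⊥-elim (Y-empty (_ , y∈Y))))
      ... | yes (x , x∈Y) = Spans-⊆ (p⊆p-x∪⁅x⁆ Y x) (Spans-∪
        (go (Y - x) (smaller (x∈p⇒p-x⊂p x∈Y)) (λ e∈Y-x → spans-points (p─q⊆p Y ⁅ x ⁆ e∈Y-x)))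
        (spans-points x∈Y))

  rank-increase : ∀ S → r S < rank M → ∃ λ x → r S < r (S ∪ ⁅ x ⁆)
  rank-increase S S<rank with any? (λ x → r S <? r (S ∪ ⁅ x ⁆))
  ... | yes increase = increase
  ... | no none      = ⊥-elim (<⇒≱ S<rank (≤-trans (r-mono (q⊆p∪q S ⊤))
                         (Spans-pointwise ⊤ (λ {e} _ → ≮⇒≥ (λ S<S+e → none (e , S<S+e))))))

  closure : Subset n → Subset n
  closure S = tabulate (λ e → ⌊ spans? S ⁅ e ⁆ ⌋)

  ∈-closure⁺ : ∀ {S e} → Spans S ⁅ e ⁆ → e ∈ closure S
  ∈-closure⁺ {S} {e} spans = lookup⇒[]= e (closure S)
    (trans (lookup∘tabulate (λ e → ⌊ spans? S ⁅ e ⁆ ⌋) e)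
           (Equivalence.to T-≡ (fromWitness spans)))

  ∈-closure⁻ : ∀ {S e} → e ∈ closure S → Spans S ⁅ e ⁆
  ∈-closure⁻ {S} {e} e∈cl = toWitness (Equivalence.from T-≡
    (trans (sym (lookup∘tabulate (λ e → ⌊ spans? S ⁅ e ⁆ ⌋) e)) ([]=⇒lookup e∈cl)))

  ⊆-closure : ∀ S → S ⊆ closure S
  ⊆-closure S e∈S = ∈-closure⁺ (r-mono (∪-least ⊆-refl (x∈p⇒⁅x⁆⊆p e∈S)))

  r-closure : ∀ S → r (closure S) ≡ r S
  r-closure S = ≤-antisym
    (≤-trans (r-mono (q⊆p∪q S (closure S))) (Spans-pointwise (closure S) ∈-closure⁻))
    (r-mono (⊆-closure S))

  closure-isFlat : ∀ S → IsFlat M (closure S)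
  closure-isFlat S e e∉cl = begin-strict
    r (closure S)            ≡⟨ r-closure S ⟩
    r S                      <⟨ ≮⇒≥ (λ S+e≤S → e∉cl (∈-closure⁺ (≤-pred S+e≤S))) ⟩
    r (S ∪ ⁅ e ⁆)            ≤⟨ r-mono (∪-least (λ s → p⊆p∪q ⁅ e ⁆ (⊆-closure S s)) (q⊆p∪q _ ⁅ e ⁆)) ⟩
    r (closure S ∪ ⁅ e ⁆)    ∎
    where open ≤-Reasoning

  ∉-closure-∪⁅⁆ : ∀ {A S x b} → IsFlat M A → A ⊆ S → r S < r (S ∪ ⁅ x ⁆) → b ∈ S → b ∉ A →
                  b ∉ closure (A ∪ ⁅ x ⁆)
  ∉-closure-∪⁅⁆ {A} {S} {x} {b} fA A⊆S S<S+x b∈S b∉A b∈cl =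
    n≮n (r S) (+-cancelˡ-≤ (suc (r A)) _ _ (begin
      suc (r A) + suc (r S)      ≡⟨ +-comm (suc (r A)) (suc (r S)) ⟩
      suc (r S) + suc (r A)      ≤⟨ +-mono-≤ gain-union gain-meet ⟩
      r (X ∪ S) + r (X ∩ S)      ≤⟨ r-submod X S ⟩
      r X + r S                  ≤⟨ +-monoˡ-≤ (r S) (≤-trans (∈-closure⁻ b∈cl) (r-∪⁅⁆ A x)) ⟩
      suc (r A) + r S            ∎))
    where
      open ≤-Reasoning
      X = (A ∪ ⁅ x ⁆) ∪ ⁅ b ⁆
      gain-union : r S < r (X ∪ S)
      gain-union = <-≤-trans S<S+x (r-mono (∪-least (q⊆p∪q X S)
        (λ y → p⊆p∪q S (p⊆p∪q ⁅ b ⁆ (q⊆p∪q A ⁅ x ⁆ y)))))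
      gain-meet : r A < r (X ∩ S)
      gain-meet = flat⇒r< fA (∩-greatest (λ a → p⊆p∪q ⁅ b ⁆ (p⊆p∪q ⁅ x ⁆ a)) A⊆S)
        (x∈p∩q⁺ (q⊆p∪q _ ⁅ b ⁆ (x∈⁅x⁆ b) , b∈S)) b∉A

  disjoint-flat-extension : ∀ {A B} → IsFlat M A → Empty (A ∩ B) → r (A ∪ B) < rank M →
    ∃ λ Q → IsFlat M Q × r Q ≡ suc (r A) × Empty (Q ∩ B)
  disjoint-flat-extension {A} {B} fA A∩B-empty S<rank with rank-increase (A ∪ B) S<rank
  ... | x , S<S+x = closure T , closure-isFlat T , trans (r-closure T) rT , Q∩B-empty
    where
      T = A ∪ ⁅ x ⁆
      x∉A : x ∉ A
      x∉A x∈A = <⇒≱ S<S+x (r-mono (∪-least ⊆-refl (x∈p⇒⁅x⁆⊆p (p⊆p∪q B x∈A))))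
      rT : r T ≡ suc (r A)
      rT = ≤-antisym (r-∪⁅⁆ A x) (fA x x∉A)
      Q∩B-empty : Empty (closure T ∩ B)
      Q∩B-empty (b , b∈Q∩B) with x∈p∩q⁻ (closure T) B b∈Q∩B
      ... | b∈Q , b∈B = ∉-closure-∪⁅⁆ fA (p⊆p∪q B) S<S+x (q⊆p∪q A B b∈B)
                          (λ b∈A → A∩B-empty (b , x∈p∩q⁺ (b∈A , b∈B))) b∈Q

  IsModular⇒¬HasDisjoint32 : rank M ≡ 4 → IsModular M → ¬ HasDisjoint32 M
  IsModular⇒¬HasDisjoint32 rank≡4 modular (A , B , fA , fB , rA≡3 , rB≡2 , A∩B-empty) =
    n≮n 4 (begin-strict
      4                       <⟨ ≤-refl ⟩
      3 + 2                   ≡⟨ cong₂ _+_ (sym rA≡3) (sym rB≡2) ⟩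
      r A + r B               ≡⟨ sym (modular A B fA fB) ⟩
      r (A ∪ B) + r (A ∩ B)   ≤⟨ +-mono-≤ (≤-trans (r≤rank (A ∪ B)) (≤-reflexive rank≡4))
                                          (≤-reflexive (r-empty A∩B-empty)) ⟩
      4                       ∎)
    where open ≤-Reasoning

module _ {n : ℕ} (M : Matroid n) (loopless : Loopless M) (rank≡4 : rank M ≡ 4)
         (hyper : Hypermodular M) (no32 : ¬ HasDisjoint32 M) where
  open Matroid M

  r<⇒r≤3 : ∀ {A X} → r A < r X → r A ≤ 3
  r<⇒r≤3 {X = X} rA<rX = ≤-pred (≤-trans rA<rX (≤-trans (r≤rank M X) (≤-reflexive rank≡4)))

  disjoint-lines-span : ∀ {A B} → IsFlat M A → IsFlat M B → Empty (A ∩ B) →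
                        r A ≡ 2 → r B ≡ 2 → 4 ≤ r (A ∪ B)
  disjoint-lines-span {A} {B} fA fB A∩B-empty rA≡2 rB≡2 = ≮⇒≥ λ S<4 →
    let (Q , fQ , rQ , Q∩B-empty) = disjoint-flat-extension M fA A∩B-empty
                                      (<-≤-trans S<4 (≤-reflexive (sym rank≡4)))
    in no32 (Q , B , fQ , fB , trans rQ (cong suc rA≡2) , rB≡2 , Q∩B-empty)

  disjoint-line-supermodular : ∀ {A B} → IsFlat M A → IsFlat M B → Empty (A ∩ B) →
    r A ≡ 2 → r A ≤ r B → r B < r (A ∪ B) → r A + r B ≤ r (A ∪ B)
  disjoint-line-supermodular {A} {B} fA fB A∩B-empty rA≡2 rA≤rB rB<rA∪B
    with m≤n⇒m<n∨m≡n (r<⇒r≤3 rB<rA∪B)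
  ... | inj₂ rB≡3 =
    ⊥-elim (no32 (B , A , fB , fA , rB≡3 , rA≡2 , subst Empty (∩-comm A B) A∩B-empty))
  ... | inj₁ rB<3 = begin
    r A + r B  ≡⟨ cong₂ _+_ rA≡2 rB≡2 ⟩
    4          ≤⟨ disjoint-lines-span fA fB A∩B-empty rA≡2 rB≡2 ⟩
    r (A ∪ B)  ∎
    where
      open ≤-Reasoning
      rB≡2 : r B ≡ 2
      rB≡2 = ≤-antisym (≤-pred rB<3) (≤-trans (≤-reflexive (sym rA≡2)) rA≤rB)

  ⊈∧r≤⇒ModularPair : ∀ {A B e} → IsFlat M A → IsFlat M B → e ∈ A → e ∉ B → r A ≤ r B →
                     ModularPair M A B
  ⊈∧r≤⇒ModularPair {A} {B} fA fB e∈A e∉B rA≤rB = ≤-antisym (r-submod A B) supermodular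
    where
      rB<rA∪B : r B < r (A ∪ B)
      rB<rA∪B = flat⇒r< M fB (q⊆p∪q A B) (p⊆p∪q B e∈A) e∉B
      supermodular : r A + r B ≤ r (A ∪ B) + r (A ∩ B)
      supermodular with m≤n⇒m<n∨m≡n (≤-trans rA≤rB (r<⇒r≤3 rB<rA∪B))
      ... | inj₂ rA≡3 = ≤-reflexive (sym (proj₂ hyper A B fA fB rA≡3 rB≡3))
        where
          rB≡3 : r B ≡ 3
          rB≡3 = ≤-antisym (r<⇒r≤3 rB<rA∪B) (≤-trans (≤-reflexive (sym rA≡3)) rA≤rB)
      ... | inj₁ rA<3 with nonempty? (A ∩ B)
      ...   | yes (_ , x∈A∩B) =
        m≤1+o⇒n<p⇒m+n≤p+o (≤-trans (≤-pred rA<3) (s≤s (Loopless⇒1≤r M loopless x∈A∩B))) rB<rA∪B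
      ...   | no A∩B-empty with r A ≤? 1
      ...     | yes rA≤1 = m≤1+o⇒n<p⇒m+n≤p+o (≤-trans rA≤1 (s≤s z≤n)) rB<rA∪B
      ...     | no rA≰1  = ≤-trans (disjoint-line-supermodular fA fB A∩B-empty
                                      (≤-antisym (≤-pred rA<3) (≰⇒> rA≰1)) rA≤rB rB<rA∪B)
                                   (m≤m+n _ _)

  r≤⇒ModularPair : ∀ {A B} → IsFlat M A → IsFlat M B → r A ≤ r B → ModularPair M A B
  r≤⇒ModularPair {A} {B} fA fB rA≤rB with A ⊆? B
  ... | yes A⊆B = ⊆⇒ModularPair M A⊆B
  ... | no A⊈B with ⊈⇒∃∉ A⊈B
  ...   | e , e∈A , e∉B = ⊈∧r≤⇒ModularPair fA fB e∈A e∉B rA≤rB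

  ¬HasDisjoint32⇒IsModular : IsModular M
  ¬HasDisjoint32⇒IsModular A B fA fB with ≤-total (r A) (r B)
  ... | inj₁ rA≤rB = r≤⇒ModularPair fA fB rA≤rB
  ... | inj₂ rB≤rA = ModularPair-sym M (r≤⇒ModularPair fB fA rB≤rA)

lemma3p4 : ∀ {n : ℕ} (M : Matroid n) → Loopless M → rank M ≡ 4 → Hypermodular M →
    ((¬ HasDisjoint32 M → IsModular M) × (IsModular M → ¬ HasDisjoint32 M))
lemma3p4 M loopless rank≡4 hyper =
  ¬HasDisjoint32⇒IsModular M loopless rank≡4 hyper , IsModular⇒¬HasDisjoint32 M rank≡4
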